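{- Consider the generic DEPQ construction described in the context, where $\mathit{MinPQ}$ and $\mathit{MaxPQ}$ are linearizable single-consumer priority queues (so each of their operations is treated as an atomic step), and let $\alpha$ be an execution in which at most one process at a time performs DEPQ \textsc{ExtractMin} operations and at most one process at a time performs DEPQ \textsc{ExtractMax} operations. For each DEPQ \textsc{Extract} operation $e$ (an \textsc{ExtractMin} or \textsc{ExtractMax}) that performs at least one \textsc{ExtractMin} on $\mathit{MinPQ}$ or $\mathit{MaxPQ}$, let $last_e$ be the last such step of $e$ and $result_e$ the value it returns. Define a linearization of $\alpha$ as follows: (L1) an \textsc{Extract} operation $e$ is linearized at $last_e$ if $result_e=\mathit{nil}$ or $e$ performs a successful \textsc{TestAndSet} (one returning $0$); other \textsc{Extract} operations are not linearized. (L2) each DEPQ \textsc{Insert} operation is linearized at the earlier of (a) its insertion into $\mathit{MaxPQ}$ and (b) the point immediately before the linearization point of the DEPQ \textsc{Extract} operation that returns its key; if neither occurs, it is not linearized. Then in the sequential DEPQ execution defined by this linearization, each linearized \textsc{Extract} operation $e$ returns $result_e$ (more precisely, returns $\mathit{nil}$ if $result_e=\mathit{nil}$ and otherwise returns the key of the item $result_e$).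
   Context: Model: asynchronous processes communicating through shared memory supporting reads, writes and \textsc{TestAndSet}. Let $<$ be a total order on keys and $>$ the opposite order. A priority queue $PQ(R)$ supports \textsc{Insert}$(i)$ and \textsc{ExtractMin} (removes and returns an element with $R$-minimal key, or $\mathit{nil}$ if empty), and optionally \textsc{Delete}$(i)$. $\mathit{MinPQ}$ is an instance of $PQ(<)$ and $\mathit{MaxPQ}$ an instance of $PQ(>)$. A DEPQ sequentially stores a set of keys with \textsc{Insert}$(x)$ adding $x$, \textsc{ExtractMin}/\textsc{ExtractMax} removing and returning the $<$-smallest/$<$-largest key, or $\mathit{nil}$ if empty. Standing assumption: all keys inserted are distinct. Construction: items have a field \textit{key} and a bit \textit{reserved}. DEPQ \textsc{Insert}$(x)$: create item $i$ with key $x$, reserved $=0$; $\mathit{MinPQ}.\textsc{Insert}(i)$; then $\mathit{MaxPQ}.\textsc{Insert}(i)$. DEPQ \textsc{ExtractMin}: loop: $x:=\mathit{MinPQ}.\textsc{ExtractMin}$; if $x=\mathit{nil}$ return $\mathit{nil}$; else if $\textsc{TestAndSet}(x.\mathit{reserved})=0$, optionally perform $\mathit{MaxPQ}.\textsc{Delete}(x)$, and return $x.\mathit{key}$. DEPQ \textsc{ExtractMax}: symmetric, using $\mathit{MaxPQ}.\textsc{ExtractMin}$ and optionally $\mathit{MinPQ}.\textsc{Delete}(x)$. -}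

module Defs where

open import Data.Nat using (ℕ; zero; suc; _≤_; _<_; _*_; _≟_)
open import Data.Bool using (Bool; true; false)
open import Data.Maybe using (Maybe; just; nothing)
open import Data.Product using (Σ; _×_; _,_; proj₁; proj₂; ∃)
open import Data.Sum using (_⊎_)
open import Data.List using (List; []; _∷_; map)
open import Data.List.Relation.Unary.All using (All)
open import Data.List.Relation.Unary.Linked using (Linked)
open import Data.List.Membership.Propositional using (_∈_)
open import Data.List.Relation.Binary.Permutation.Propositional using (_↭_)
open import Relation.Nullary using (¬_; yes; no)
open import Relation.Binary.PropositionalEquality using (_≡_)

at : {A : Set} → List A → ℕ → Maybe A
at []       _       = nothing
at (x ∷ xs) zero    = just x
at (x ∷ xs) (suc k) = at xs k

upd : {A : Set} → (ℕ → A) → ℕ → A → ℕ → A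
upd f n a m with m ≟ n
... | yes _ = a
... | no  _ = f m

-- Sides: which of the two underlying priority queues
-- (min = MinPQ, an instance of PQ(<);  max = MaxPQ, an instance of PQ(>))

data Side : Set where
  min max : Side

opp : Side → Side
opp min = max
opp max = min

module _ {Key : Set} where

  -- An item: (identifier, key).  The identifier of the item created by a
  -- DEPQ Insert operation is the identifier of that Insert operation.
  Item : Set
  Item = ℕ × Key

  data OpKind : Set where
    ins : Key → OpKind
    ext : Side → OpKind

  -- Atomic steps (events) of the implementation.  Operations of MinPQ /
  -- MaxPQ are atomic (linearizable).  TestAndSet returns the old bit
  -- (false = 0, true = 1).
  data Action : Set where
    invoke  : OpKind → Action
    pqIns   : Side → Action                 -- (Min|Max)PQ.Insert(own item)
    pqExt   : Side → Maybe Item → Action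
    tas     : ℕ → Bool → Action             -- TestAndSet(item.reserved) returned this
    pqDel   : Side → ℕ → Action
    respond : Maybe Key → Action

  -- an event: (identifier of the DEPQ operation performing it, action)
  Event : Set
  Event = ℕ × Action

  data PC : Set where
    idle       : PC
    insMinPC   : Item → PC
    insMaxPC   : Item → PC
    insDone    : PC
    extTry     : Side → PC
    extTas     : Side → Item → PC
    extWon     : Side → Item → PC
    extDeleted : Side → Item → PC
    extNil     : Side → PC
    finished   : PC

  record State : Set where
    constructor st
    field
      qMin qMax : List Item
      reserved  : ℕ → Bool          -- reserved bit of the item with given identifier
      pc        : ℕ → PC
  open State public

  initState : State
  initState = st [] [] (λ _ → false) (λ _ → idle)

  Q : Side → State → List Item
  Q min s = qMin s
  Q max s = qMax s

  setQ : Side → List Item → State → State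
  setQ min q (st _ b r p) = st q b r p
  setQ max q (st a _ r p) = st a q r p

  setPC : ℕ → PC → State → State
  setPC o c (st a b r p) = st a b r (upd p o c)

  setRes : ℕ → State → State
  setRes j (st a b r p) = st a b (upd r j true) p

  removeId : ℕ → List Item → List Item
  removeId j [] = []
  removeId j (i ∷ q) with proj₁ i ≟ j
  ... | yes _ = removeId j q
  ... | no  _ = i ∷ removeId j q

  module _ (_<ₖ_ : Key → Key → Set) where

    ord : Side → Key → Key → Set
    ord min x y = x <ₖ y
    ord max x y = y <ₖ x

    IsMinIn : Side → Item → List Item → Set
    IsMinIn d i q = i ∈ q × All (λ j → ¬ ord d (proj₂ j) (proj₂ i)) q

    data Step (s : State) : Event → State → Set where
      invIns  : ∀ {o x} → pc s o ≡ idle →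
                Step s (o , invoke (ins x)) (setPC o (insMinPC (o , x)) s)
      invExt  : ∀ {o d} → pc s o ≡ idle →
                Step s (o , invoke (ext d)) (setPC o (extTry d) s)
      insMinQ : ∀ {o i} → pc s o ≡ insMinPC i →
                Step s (o , pqIns min) (setPC o (insMaxPC i) (setQ min (i ∷ qMin s) s))
      insMaxQ : ∀ {o i} → pc s o ≡ insMaxPC i →
                Step s (o , pqIns max) (setPC o insDone (setQ max (i ∷ qMax s) s))
      insRet  : ∀ {o} → pc s o ≡ insDone →
                Step s (o , respond nothing) (setPC o finished s)
      extEmpty : ∀ {o d} → pc s o ≡ extTry d → Q d s ≡ [] →
                Step s (o , pqExt d nothing) (setPC o (extNil d) s)
      extGot  : ∀ {o d i} → pc s o ≡ extTry d → IsMinIn d i (Q d s) →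
                Step s (o , pqExt d (just i))
                       (setPC o (extTas d i) (setQ d (removeId (proj₁ i) (Q d s)) s))
      tasFail : ∀ {o d i} → pc s o ≡ extTas d i → reserved s (proj₁ i) ≡ true →
                Step s (o , tas (proj₁ i) true) (setPC o (extTry d) s)
      tasWin  : ∀ {o d i} → pc s o ≡ extTas d i → reserved s (proj₁ i) ≡ false →
                Step s (o , tas (proj₁ i) false) (setPC o (extWon d i) (setRes (proj₁ i) s))
      extDel  : ∀ {o d i} → pc s o ≡ extWon d i →
                Step s (o , pqDel (opp d) (proj₁ i))
                       (setPC o (extDeleted d i)
                              (setQ (opp d) (removeId (proj₁ i) (Q (opp d) s)) s))
      retKey  : ∀ {o d i} → (pc s o ≡ extWon d i ⊎ pc s o ≡ extDeleted d i) →
                Step s (o , respond (just (proj₂ i))) (setPC o finished s)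
      retNil  : ∀ {o d} → pc s o ≡ extNil d →
                Step s (o , respond nothing) (setPC o finished s)

    data Run : State → List Event → State → Set where
      done : ∀ {s} → Run s [] s
      step : ∀ {s e s' es s''} → Step s e s' → Run s' es s'' → Run s (e ∷ es) s''

    Execution : List Event → Set
    Execution α = Σ State λ s → Run initState α s

  module _ (α : List Event) where

    Ev : ℕ → ℕ → Action → Set
    Ev k o a = at α k ≡ just (o , a)

    PendingExt : Side → ℕ → ℕ → Set
    PendingExt d n o =
      (Σ ℕ λ k → k < n × Ev k o (invoke (ext d))) ×
      ¬ (Σ ℕ λ k → Σ (Maybe Key) λ v → k < n × Ev k o (respond v))

    OneAtATime : Side → Set
    OneAtATime d = ∀ n o o' → PendingExt d n o → PendingExt d n o' → o ≡ o'

    DistinctKeys : Set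
    DistinctKeys = ∀ k k' o o' x → Ev k o (invoke (ins x)) → Ev k' o' (invoke (ins x)) → o ≡ o'

    Invoked : ℕ → OpKind → Set
    Invoked o κ = Σ ℕ λ k → Ev k o (invoke κ)

    ExtAt : ℕ → ℕ → Maybe Item → Set
    ExtAt o k r = Σ Side λ d → Ev k o (pqExt d r)

    LastExt : ℕ → ℕ → Maybe Item → Set
    LastExt o k r = ExtAt o k r × (∀ k' r' → ExtAt o k' r' → k' ≤ k)

    SuccTAS : ℕ → Set
    SuccTAS o = Σ ℕ λ k → Σ ℕ λ j → Ev k o (tas j false)

    LinExt : ℕ → ℕ → Maybe Item → Set
    LinExt o k r = LastExt o k r × (r ≡ nothing ⊎ SuccTAS o)

    ReturnedBy : ℕ → ℕ → ℕ → Set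
    ReturnedBy o e k = Σ Key λ x → LinExt e k (just (o , x))

    MaxInsAt : ℕ → ℕ → Set
    MaxInsAt o k = Ev k o (pqIns max)

    -- Positions: 2k+1 = "at event k";  2k = "immediately before event k".
    -- (L2): Insert o is linearized at position p.
    LinIns : ℕ → ℕ → Set
    LinIns o p =
      (Σ ℕ λ k → MaxInsAt o k × p ≡ suc (2 * k) ×
         (∀ e k' → ReturnedBy o e k' → k < k'))
      ⊎
      (Σ ℕ λ e → Σ ℕ λ k' → ReturnedBy o e k' × p ≡ 2 * k' ×
         (∀ k → MaxInsAt o k → k' < k))

  data HEntry : Set where
    hIns : Key → HEntry
    hExt : Side → Maybe Key → HEntry

  module _ (α : List Event) where

    data Lin : ℕ → ℕ → HEntry → Set where
      linIns : ∀ {o p x} → Invoked α o (ins x) → LinIns α o p → Lin o p (hIns x)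
      linExt : ∀ {o d k r} → Invoked α o (ext d) → LinExt α o k r →
               Lin o (suc (2 * k)) (hExt d (Data.Maybe.map proj₂ r))

    LinEntry : Set
    LinEntry = ℕ × ℕ × HEntry     -- (operation, position, sequential operation)

    Enumerates : List LinEntry → Set
    Enumerates L =
      All (λ e → Lin (proj₁ e) (proj₁ (proj₂ e)) (proj₂ (proj₂ e))) L ×
      (∀ o p h → Lin o p h → (o , p , h) ∈ L) ×
      Linked (λ e e' → proj₁ (proj₂ e) < proj₁ (proj₂ e')) L

  module _ (_<ₖ_ : Key → Key → Set) where
    data Legal : List Key → List HEntry → Set where
      lNil      : ∀ {S} → Legal S []
      lIns      : ∀ {S x H} → Legal (x ∷ S) H → Legal S (hIns x ∷ H)
      lExtEmpty : ∀ {d H} → Legal [] H → Legal [] (hExt d nothing ∷ H)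
      lExtKey   : ∀ {S S' d x H} → S ↭ (x ∷ S') → All (ord _<ₖ_ d x) S' →
                  Legal S' H → Legal S (hExt d (just x) ∷ H)

-- The key set of the sequential DEPQ after a prefix of the linearized history is forced: the keys
-- inserted and not yet extracted.  So it suffices that each linearized operation is admissible after
-- its predecessors: an inserted key is new, an Extract returning nil sees no live key, and an Extract
-- returning x sees x live and extremal among the live keys.  The heart of the argument is that a key
-- live at the linearization point k of an Extract on side d sits in queue d at time k.  Its Insert
-- pushed it there before k, and it can only have left through a Delete by the winner of its
-- TestAndSet, through an extraction whose TestAndSet was decided before k (both make some Extract
-- returning it linearized before k), or through an extraction still holding it at k, which would be a
-- second Extract on side d in progress.  The queue operation at k then returns the extremal item of
-- queue d, or nil only when queue d is empty.

module Submission where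

open import Defs
open import Data.Nat using (ℕ; zero; suc; _≤_; _<_; _≤′_; ≤′-refl; ≤′-step; _≟_; z≤n; s≤s; s≤s⁻¹; _*_)
open import Data.Nat.Properties
  using (≤-refl; ≤-trans; ≤-reflexive; ≤-antisym; <-irrefl; <-asym; <-trans; <-≤-trans; ≤-<-trans;
         <-cmp; <⇒≤; n≤1+n; n<1+n; m<n⇒m<1+n; m<1+n⇒m<n∨m≡n; ≤⇒≤′; ≤⇒≤ᵇ;
         *-monoʳ-<; *-cancelˡ-≤; *-cancelˡ-<; anyUpTo?)
open import Data.Bool using (Bool; true; false)
open import Data.Unit using (⊤; tt)
open import Data.Empty using (⊥-elim)
open import Data.Product using (Σ; _×_; _,_; proj₁; proj₂; map₂)
open import Data.Sum using (_⊎_; inj₁; inj₂; [_,_]′)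
open import Data.Maybe using (just; nothing)
open import Data.List using (List; []; _∷_; _++_; [_]; map)
open import Data.List.Properties using (++-assoc; map-++)
open import Data.List.Relation.Unary.Any using (here; there)
open import Data.List.Relation.Unary.All using (All)
import Data.List.Relation.Unary.All as All
open import Data.List.Relation.Unary.AllPairs using (AllPairs; []; _∷_)
open import Data.List.Relation.Unary.Linked.Properties using (Linked⇒AllPairs)
open import Data.List.Relation.Unary.Unique.Propositional using (Unique)
open import Data.List.Membership.Propositional using (_∈_; _∉_)
open import Data.List.Membership.Propositional.Properties
  using (∈-∃++; ∈-++⁻; ∈-++⁺ˡ; ∈-++⁺ʳ; ∈-map⁻; ∈-map⁺)
open import Data.List.Relation.Binary.Permutation.Propositional using (_↭_; ↭-sym; ↭⇒↭ₛ)
open import Data.List.Relation.Binary.Permutation.Propositional.Properties using (∈-resp-↭; shift)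
import Data.List.Relation.Binary.Permutation.Setoid.Properties as PermutationSetoid
open import Function using (_∘_; case_of_)
open import Relation.Nullary using (¬_; Dec; yes; no)
open import Relation.Binary.Definitions using (tri<; tri≈; tri>)
open import Relation.Binary.Structures using (IsStrictTotalOrder)
open import Relation.Binary.PropositionalEquality using (_≡_; _≢_; refl; sym; trans; cong; subst; setoid)

upd-same : ∀ {A : Set} (f : ℕ → A) n a → upd f n a n ≡ a
upd-same f n a with n ≟ n
... | yes _ = refl
... | no n≢n = ⊥-elim (n≢n refl)

upd-other : ∀ {A : Set} (f : ℕ → A) n a {m} → m ≢ n → upd f n a m ≡ f m
upd-other f n a {m} m≢n with m ≟ n
... | yes m≡n = ⊥-elim (m≢n m≡n)
... | no _ = refl

upward-closed : ∀ (P : ℕ → Set) → (∀ {t} → P t → P (suc t)) → ∀ {t t'} → t ≤ t' → P t → P t'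
upward-closed P next t≤t' = go (≤⇒≤′ t≤t')
  where
  go : ∀ {t t'} → t ≤′ t' → P t → P t'
  go ≤′-refl p = p
  go (≤′-step t≤′t') p = next (go t≤′t' p)

module _ {A : Set} (pos : A → ℕ) where

  Increasing : List A → Set
  Increasing = AllPairs (λ a b → pos a < pos b)

  increasing-prefix : ∀ P {a R b} → Increasing (P ++ a ∷ R) → b ∈ P → pos b < pos a
  increasing-prefix (_ ∷ P) (first ∷ _) (here refl) = All.lookup first (∈-++⁺ʳ P (here refl))
  increasing-prefix (_ ∷ P) (_ ∷ inc)   (there m)   = increasing-prefix P inc m

  increasing-smaller⇒prefix : ∀ P {a R b} → Increasing (P ++ a ∷ R) → b ∈ P ++ a ∷ R → pos b < pos a →
                              b ∈ P
  increasing-smaller⇒prefix []      _           (here refl) b<a = ⊥-elim (<-irrefl refl b<a)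
  increasing-smaller⇒prefix []      (first ∷ _) (there m)   b<a = ⊥-elim (<-asym b<a (All.lookup first m))
  increasing-smaller⇒prefix (_ ∷ P) _           (here refl) _   = here refl
  increasing-smaller⇒prefix (_ ∷ P) (_ ∷ inc)   (there m)   b<a = there (increasing-smaller⇒prefix P inc m b<a)

module SequentialDEPQ {Key : Set} (_<ₖ_ : Key → Key → Set) where

  NotExtracted : List (HEntry {Key}) → Key → Set
  NotExtracted H y = ∀ d → hExt d (just y) ∉ H

  Live : List (HEntry {Key}) → Key → Set
  Live H y = hIns y ∈ H × NotExtracted H y

  Admissible : List (HEntry {Key}) → HEntry → Set
  Admissible H (hIns x)          = hIns x ∉ H × NotExtracted H x
  Admissible H (hExt d nothing)  = ∀ y → ¬ Live H y
  Admissible H (hExt d (just x)) = Live H x × (∀ y → Live H y → y ≢ x → ord _<ₖ_ d x y)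

  record Tracks (S : List Key) (H : List (HEntry {Key})) : Set where
    field
      unique : Unique S
      live⇒∈ : ∀ {y} → Live H y → y ∈ S
      ∈⇒live : ∀ {y} → y ∈ S → Live H y
  open Tracks

  private
    ∈-snoc⁻ : ∀ {A : Set} {a h : A} H → a ∈ H ++ [ h ] → a ∈ H ⊎ a ≡ h
    ∈-snoc⁻ H m with ∈-++⁻ H m
    ... | inj₁ p = inj₁ p
    ... | inj₂ (here refl) = inj₂ refl

    live-snoc⁺ : ∀ {H h y} → Live H y → (∀ d → h ≢ hExt d (just y)) → Live (H ++ [ h ]) y
    live-snoc⁺ {H} (i , ne) h≢ = ∈-++⁺ˡ i , λ d m → [ ne d , (λ eq → h≢ d (sym eq)) ]′ (∈-snoc⁻ H m)

    live-snoc⁻ : ∀ {H h y} → Live (H ++ [ h ]) y → Live H y ⊎ h ≡ hIns y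
    live-snoc⁻ {H} (i , ne) with ∈-snoc⁻ H i
    ... | inj₁ p  = inj₁ (p , λ d m → ne d (∈-++⁺ˡ m))
    ... | inj₂ eq = inj₂ (sym eq)

  tracks-[] : Tracks [] []
  tracks-[] = record { unique = [] ; live⇒∈ = λ { (() , _) } ; ∈⇒live = λ () }

  tracks-ins : ∀ {S H x} → Tracks S H → Admissible H (hIns x) → Tracks (x ∷ S) (H ++ [ hIns x ])
  tracks-ins {H = H} t (x∉ , nx) = record
    { unique = All.tabulate (λ { m refl → x∉ (proj₁ (∈⇒live t m)) }) ∷ unique t
    ; live⇒∈ = λ l → [ there ∘ live⇒∈ t , (λ { refl → here refl }) ]′ (live-snoc⁻ l)
    ; ∈⇒live = λ { (here refl) → ∈-++⁺ʳ H (here refl) , λ d m → [ nx d , (λ ()) ]′ (∈-snoc⁻ H m)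
                 ; (there m)   → live-snoc⁺ (∈⇒live t m) (λ _ ()) }
    }

  tracks-nil : ∀ {S H d} → Tracks S H → Admissible H (hExt d nothing) → Tracks S (H ++ [ hExt d nothing ])
  tracks-nil t _ = record
    { unique = unique t
    ; live⇒∈ = λ l → [ live⇒∈ t , (λ ()) ]′ (live-snoc⁻ l)
    ; ∈⇒live = λ m → live-snoc⁺ (∈⇒live t m) (λ _ ())
    }

  tracks-ext : ∀ {S H d x} → Tracks S H → Admissible H (hExt d (just x)) →
               Σ (List Key) λ S' → S ↭ x ∷ S' × All (ord _<ₖ_ d x) S' × Tracks S' (H ++ [ hExt d (just x) ])
  tracks-ext {H = H} {d} {x} t (x-live , least) with ∈-∃++ (live⇒∈ t x-live)
  ... | ys , zs , refl = ys ++ zs , σ , All.tabulate (λ m → least _ (live m) (≢x m)) , record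
    { unique = uniqueTail x∷S'-unique
    ; live⇒∈ = λ l → [ survives l , (λ ()) ]′ (live-snoc⁻ l)
    ; ∈⇒live = λ m → live-snoc⁺ (live m) (λ { _ refl → ≢x m refl })
    }
    where
    σ : ys ++ [ x ] ++ zs ↭ x ∷ ys ++ zs
    σ = shift x ys zs
    x∷S'-unique : Unique (x ∷ ys ++ zs)
    x∷S'-unique = PermutationSetoid.Unique-resp-↭ (setoid Key) (↭⇒↭ₛ σ) (unique t)
    uniqueTail : ∀ {xs : List Key} → Unique (x ∷ xs) → Unique xs
    uniqueTail (_ ∷ u) = u
    ≢x : ∀ {y} → y ∈ ys ++ zs → y ≢ x
    ≢x m refl with x∷S'-unique
    ... | x∉ ∷ _ = All.lookup x∉ m refl
    live : ∀ {y} → y ∈ ys ++ zs → Live H y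
    live m = ∈⇒live t (∈-resp-↭ (↭-sym σ) (there m))
    survives : ∀ {y} → Live (H ++ [ hExt d (just x) ]) y → Live H y → y ∈ ys ++ zs
    survives (_ , ne) l with ∈-resp-↭ σ (live⇒∈ t l)
    ... | here refl = ⊥-elim (ne d (∈-++⁺ʳ H (here refl)))
    ... | there m = m

  legal-step : ∀ {S H h R} → Tracks S H → Admissible H h →
               (∀ {S'} → Tracks S' (H ++ [ h ]) → Legal _<ₖ_ S' R) → Legal _<ₖ_ S (h ∷ R)
  legal-step {h = hIns _}                  t adm rest = lIns (rest (tracks-ins t adm))
  legal-step {[]}    {h = hExt _ nothing}  t adm rest = lExtEmpty (rest (tracks-nil t adm))
  legal-step {y ∷ _} {h = hExt _ nothing}  t adm rest = ⊥-elim (adm y (∈⇒live t (here refl)))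
  legal-step {h = hExt _ (just _)}         t adm rest with tracks-ext t adm
  ... | _ , σ , least , t' = lExtKey σ least (rest t')

  legal-if-admissible : ∀ {A : Set} (f : A → HEntry) (L : List A) →
                        (∀ P a R → L ≡ P ++ a ∷ R → Admissible (map f P) (f a)) →
                        Legal _<ₖ_ [] (map f L)
  legal-if-admissible f L adm = go [] L refl tracks-[]
    where
    go : ∀ {S} P R → P ++ R ≡ L → Tracks S (map f P) → Legal _<ₖ_ S (map f R)
    go P []      _  _ = lNil
    go P (a ∷ R) eq t = legal-step t (adm P a R (sym eq)) λ {S'} t' →
      go (P ++ [ a ]) R (trans (++-assoc P [ a ] R) eq) (subst (Tracks S') (sym (map-++ f P [ a ])) t')

module _ {Key : Set} where

  data OpStep (o : ℕ) : Action {Key} → PC {Key} → PC {Key} → Set where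
    pInvIns : ∀ {x} → OpStep o (invoke (ins x)) idle (insMinPC (o , x))
    pInvExt : ∀ {d} → OpStep o (invoke (ext d)) idle (extTry d)
    pInsMin : ∀ {i} → OpStep o (pqIns min) (insMinPC i) (insMaxPC i)
    pInsMax : ∀ {i} → OpStep o (pqIns max) (insMaxPC i) insDone
    pInsRet : OpStep o (respond nothing) insDone finished
    pEmpty  : ∀ {d} → OpStep o (pqExt d nothing) (extTry d) (extNil d)
    pGot    : ∀ {d i} → OpStep o (pqExt d (just i)) (extTry d) (extTas d i)
    pFail   : ∀ {d i} → OpStep o (tas (proj₁ i) true) (extTas d i) (extTry d)
    pWin    : ∀ {d i} → OpStep o (tas (proj₁ i) false) (extTas d i) (extWon d i)
    pDel    : ∀ {d i} → OpStep o (pqDel (opp d) (proj₁ i)) (extWon d i) (extDeleted d i)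
    pRetWon : ∀ {d i} → OpStep o (respond (just (proj₂ i))) (extWon d i) finished
    pRetDel : ∀ {d i} → OpStep o (respond (just (proj₂ i))) (extDeleted d i) finished
    pRetNil : ∀ {d} → OpStep o (respond nothing) (extNil d) finished

  -- Control states never return to an earlier phase (the retry loop extTry → extTas → extTry stays in
  -- phase 1); phaseBefore a and phaseAfter a bound the phase just before and just after performing a.
  phase : PC {Key} → ℕ
  phase idle           = 0
  phase (insMinPC _)   = 1
  phase (insMaxPC _)   = 2
  phase insDone        = 3
  phase (extTry _)     = 1
  phase (extTas _ _)   = 1
  phase (extWon _ _)   = 2
  phase (extDeleted _ _) = 3
  phase (extNil _)     = 3
  phase finished       = 4

  phaseBefore : Action {Key} → ℕ
  phaseBefore (invoke _)      = 0
  phaseBefore (pqIns min)     = 1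
  phaseBefore (pqIns max)     = 2
  phaseBefore (pqExt _ _)     = 1
  phaseBefore (tas _ _)       = 1
  phaseBefore (pqDel _ _)     = 2
  phaseBefore (respond _)     = 3

  phaseAfter : Action {Key} → ℕ
  phaseAfter (invoke _)      = 1
  phaseAfter (pqIns min)     = 2
  phaseAfter (pqIns max)     = 3
  phaseAfter (pqExt _ _)     = 1
  phaseAfter (tas _ true)    = 1
  phaseAfter (tas _ false)   = 2
  phaseAfter (pqDel _ _)     = 3
  phaseAfter (respond _)     = 4

  phaseBefore≤phaseAfter : ∀ a → phaseBefore a ≤ phaseAfter a
  phaseBefore≤phaseAfter (invoke _)    = n≤1+n 0
  phaseBefore≤phaseAfter (pqIns min)   = n≤1+n 1
  phaseBefore≤phaseAfter (pqIns max)   = n≤1+n 2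
  phaseBefore≤phaseAfter (pqExt _ _)   = ≤-refl
  phaseBefore≤phaseAfter (tas _ true)  = ≤-refl
  phaseBefore≤phaseAfter (tas _ false) = n≤1+n 1
  phaseBefore≤phaseAfter (pqDel _ _)   = n≤1+n 2
  phaseBefore≤phaseAfter (respond _)   = n≤1+n 3

  opStep-phaseBefore : ∀ {o a c c'} → OpStep o a c c' → phase c ≤ phaseBefore a
  opStep-phaseBefore pInvIns = ≤-refl
  opStep-phaseBefore pInvExt = ≤-refl
  opStep-phaseBefore pInsMin = ≤-refl
  opStep-phaseBefore pInsMax = ≤-refl
  opStep-phaseBefore pInsRet = ≤-refl
  opStep-phaseBefore pEmpty  = ≤-refl
  opStep-phaseBefore pGot    = ≤-refl
  opStep-phaseBefore pFail   = ≤-refl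
  opStep-phaseBefore pWin    = ≤-refl
  opStep-phaseBefore pDel    = ≤-refl
  opStep-phaseBefore pRetWon = n≤1+n 2
  opStep-phaseBefore pRetDel = ≤-refl
  opStep-phaseBefore pRetNil = ≤-refl

  opStep-phaseAfter : ∀ {o a c c'} → OpStep o a c c' → phaseAfter a ≤ phase c'
  opStep-phaseAfter pInvIns = ≤-refl
  opStep-phaseAfter pInvExt = ≤-refl
  opStep-phaseAfter pInsMin = ≤-refl
  opStep-phaseAfter pInsMax = ≤-refl
  opStep-phaseAfter pInsRet = ≤-refl
  opStep-phaseAfter pEmpty  = s≤s z≤n
  opStep-phaseAfter pGot    = ≤-refl
  opStep-phaseAfter pFail   = ≤-refl
  opStep-phaseAfter pWin    = ≤-refl
  opStep-phaseAfter pDel    = ≤-refl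
  opStep-phaseAfter pRetWon = ≤-refl
  opStep-phaseAfter pRetDel = ≤-refl
  opStep-phaseAfter pRetNil = ≤-refl

  opStep-phase-mono : ∀ {o a c c'} → OpStep o a c c' → phase c ≤ phase c'
  opStep-phase-mono {a = a} s =
    ≤-trans (opStep-phaseBefore s) (≤-trans (phaseBefore≤phaseAfter a) (opStep-phaseAfter s))

  opStep-pqExt : ∀ {o d r c c'} → OpStep o (pqExt d r) c c' → c ≡ extTry {Key} d
  opStep-pqExt pEmpty = refl
  opStep-pqExt pGot   = refl

  opStep-got : ∀ {o d i c c'} → OpStep o (pqExt d (just i)) c c' → c' ≡ extTas d i
  opStep-got pGot = refl

  opStep-tas : ∀ {o j b c c'} → OpStep o (tas j b) c c' →
               Σ Side λ d → Σ (Item {Key}) λ i → c ≡ extTas d i × proj₁ i ≡ j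
  opStep-tas (pFail {d} {i}) = d , i , refl , refl
  opStep-tas (pWin {d} {i})  = d , i , refl , refl

  opStep-fromTas : ∀ {o a d i c'} → OpStep o a (extTas d i) c' → Σ Bool λ b → a ≡ tas (proj₁ i) b
  opStep-fromTas pFail = true , refl
  opStep-fromTas pWin  = false , refl

  opStep-pqDel : ∀ {o d j c c'} → OpStep o (pqDel d j) c c' →
                 Σ Side λ d₀ → Σ (Item {Key}) λ i → c ≡ extWon d₀ i × proj₁ i ≡ j
  opStep-pqDel (pDel {d} {i}) = d , i , refl , refl

  pushes : Side → Item {Key} → PC {Key}
  pushes min = insMinPC
  pushes max = insMaxPC

  removeId-⊆ : ∀ {i : Item {Key}} j q → i ∈ removeId j q → i ∈ q
  removeId-⊆ j (x ∷ q) m with proj₁ x ≟ j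
  ... | yes _ = there (removeId-⊆ j q m)
  removeId-⊆ j (x ∷ q) (here eq) | no _ = here eq
  removeId-⊆ j (x ∷ q) (there m) | no _ = there (removeId-⊆ j q m)

  removeId-keeps : ∀ {i : Item {Key}} j q → i ∈ q → proj₁ i ≢ j → i ∈ removeId j q
  removeId-keeps j (x ∷ q) m i≢j with proj₁ x ≟ j
  removeId-keeps j (x ∷ q) (here refl) i≢j | yes x≡j = ⊥-elim (i≢j x≡j)
  removeId-keeps j (x ∷ q) (there m)   i≢j | yes _ = removeId-keeps j q m i≢j
  removeId-keeps j (x ∷ q) (here refl) i≢j | no _ = here refl
  removeId-keeps j (x ∷ q) (there m)   i≢j | no _ = there (removeId-keeps j q m i≢j)

  pc-setQ : ∀ d q (s : State {Key}) → pc (setQ d q s) ≡ pc s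
  pc-setQ min q s = refl
  pc-setQ max q s = refl

  reserved-setQ : ∀ d q (s : State {Key}) → reserved (setQ d q s) ≡ reserved s
  reserved-setQ min q s = refl
  reserved-setQ max q s = refl

  data Removes (d : Side) (j : ℕ) : Action {Key} → Set where
    byExtract : ∀ {i} → proj₁ i ≡ j → Removes d j (pqExt d (just i))
    byDelete  : Removes d j (pqDel d j)

  data QueueEffect (d : Side) (o : ℕ) (s : State {Key}) : Action {Key} → List (Item {Key}) → Set where
    untouched : ∀ {a} → QueueEffect d o s a (Q d s)
    pushed    : ∀ {i} → pc s o ≡ pushes d i → QueueEffect d o s (pqIns d) (i ∷ Q d s)
    removed   : ∀ {a j} → Removes d j a → QueueEffect d o s a (removeId j (Q d s))

  queueEffect-∈⁻ : ∀ {d o s a q i} → QueueEffect d o s a q → i ∈ q → i ∈ Q d s ⊎ pc s o ≡ pushes d i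
  queueEffect-∈⁻ untouched     m           = inj₁ m
  queueEffect-∈⁻ (pushed pushing) (here refl) = inj₂ pushing
  queueEffect-∈⁻ (pushed _)    (there m)   = inj₁ m
  queueEffect-∈⁻ (removed _)   m           = inj₁ (removeId-⊆ _ _ m)

  queueEffect-∈⁺ : ∀ {d o s a q i} → QueueEffect d o s a q → i ∈ Q d s → i ∈ q ⊎ Removes d (proj₁ i) a
  queueEffect-∈⁺ untouched m = inj₁ m
  queueEffect-∈⁺ (pushed _) m = inj₁ (there m)
  queueEffect-∈⁺ {i = i} (removed {j = j} r) m with proj₁ i ≟ j
  ... | yes refl = inj₂ r
  ... | no i≢j  = inj₁ (removeId-keeps j _ m i≢j)

  queues-unchanged : ∀ {s o a} d {s'} → qMin s' ≡ qMin s → qMax s' ≡ qMax s → QueueEffect d o s a (Q d s')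
  queues-unchanged min refl _ = untouched
  queues-unchanged max _ refl = untouched

  module _ (_<ₖ_ : Key → Key → Set) where

    private
      moves : ∀ {o a c c' p p'} → p ≡ c → p' ≡ c' → OpStep o a c c' → OpStep o a p p'
      moves refl refl p = p

    step-opStep : ∀ {s o a s'} → Step _<ₖ_ s (o , a) s' → OpStep o a (pc s o) (pc s' o)
    step-opStep {o = o} (invIns e)         = moves e (upd-same _ o _) pInvIns
    step-opStep {o = o} (invExt e)         = moves e (upd-same _ o _) pInvExt
    step-opStep {o = o} (insMinQ e)        = moves e (upd-same _ o _) pInsMin
    step-opStep {o = o} (insMaxQ e)        = moves e (upd-same _ o _) pInsMax
    step-opStep {o = o} (insRet e)         = moves e (upd-same _ o _) pInsRet
    step-opStep {o = o} (extEmpty e _)     = moves e (upd-same _ o _) pEmpty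
    step-opStep {o = o} (extGot e _)       = moves e (upd-same _ o _) pGot
    step-opStep {o = o} (tasFail e _)      = moves e (upd-same _ o _) pFail
    step-opStep {o = o} (tasWin e _)       = moves e (upd-same _ o _) pWin
    step-opStep {o = o} (extDel e)         = moves e (upd-same _ o _) pDel
    step-opStep {o = o} (retKey (inj₁ e))  = moves e (upd-same _ o _) pRetWon
    step-opStep {o = o} (retKey (inj₂ e))  = moves e (upd-same _ o _) pRetDel
    step-opStep {o = o} (retNil e)         = moves e (upd-same _ o _) pRetNil

    step-pc-other : ∀ {s o' a s'} o → Step _<ₖ_ s (o' , a) s' → o ≢ o' → pc s' o ≡ pc s o
    step-pc-other {s} {o'} o (extGot {d = d} _ _) o≢o' =
      trans (upd-other _ o' _ o≢o') (cong (λ f → f o) (pc-setQ d _ s))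
    step-pc-other {s} {o'} o (extDel {d = d} _) o≢o' =
      trans (upd-other _ o' _ o≢o') (cong (λ f → f o) (pc-setQ (opp d) _ s))
    step-pc-other o (invIns _)     o≢o' = upd-other _ _ _ o≢o'
    step-pc-other o (invExt _)     o≢o' = upd-other _ _ _ o≢o'
    step-pc-other o (insMinQ _)    o≢o' = upd-other _ _ _ o≢o'
    step-pc-other o (insMaxQ _)    o≢o' = upd-other _ _ _ o≢o'
    step-pc-other o (insRet _)     o≢o' = upd-other _ _ _ o≢o'
    step-pc-other o (extEmpty _ _) o≢o' = upd-other _ _ _ o≢o'
    step-pc-other o (tasFail _ _)  o≢o' = upd-other _ _ _ o≢o'
    step-pc-other o (tasWin _ _)   o≢o' = upd-other _ _ _ o≢o'
    step-pc-other o (retKey _)     o≢o' = upd-other _ _ _ o≢o'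
    step-pc-other o (retNil _)     o≢o' = upd-other _ _ _ o≢o'

    step-queue : ∀ {s o a s'} → Step _<ₖ_ s (o , a) s' → ∀ d → QueueEffect d o s a (Q d s')
    step-queue (insMinQ e) min = pushed e
    step-queue (insMinQ _) max = untouched
    step-queue (insMaxQ _) min = untouched
    step-queue (insMaxQ e) max = pushed e
    step-queue (extGot {d = min} _ _) min = removed (byExtract refl)
    step-queue (extGot {d = max} _ _) min = untouched
    step-queue (extGot {d = min} _ _) max = untouched
    step-queue (extGot {d = max} _ _) max = removed (byExtract refl)
    step-queue (extDel {d = max} _) min = removed byDelete
    step-queue (extDel {d = min} _) min = untouched
    step-queue (extDel {d = max} _) max = untouched
    step-queue (extDel {d = min} _) max = removed byDelete
    step-queue (invIns _)     d = queues-unchanged d refl refl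
    step-queue (invExt _)     d = queues-unchanged d refl refl
    step-queue (insRet _)     d = queues-unchanged d refl refl
    step-queue (extEmpty _ _) d = queues-unchanged d refl refl
    step-queue (tasFail _ _)  d = queues-unchanged d refl refl
    step-queue (tasWin _ _)   d = queues-unchanged d refl refl
    step-queue (retKey _)     d = queues-unchanged d refl refl
    step-queue (retNil _)     d = queues-unchanged d refl refl

    step-reserved : ∀ {s o a s'} → Step _<ₖ_ s (o , a) s' → ∀ j →
                    reserved s' j ≡ reserved s j ⊎ a ≡ tas j false
    step-reserved {s} (extGot {d = d} _ _) j = inj₁ (cong (λ r → r j) (reserved-setQ d _ s))
    step-reserved {s} (extDel {d = d} _)   j = inj₁ (cong (λ r → r j) (reserved-setQ (opp d) _ s))
    step-reserved {s} (tasWin {i = i} _ _) j with j ≟ proj₁ i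
    ... | yes refl = inj₂ refl
    ... | no _     = inj₁ refl
    step-reserved (invIns _)     j = inj₁ refl
    step-reserved (invExt _)     j = inj₁ refl
    step-reserved (insMinQ _)    j = inj₁ refl
    step-reserved (insMaxQ _)    j = inj₁ refl
    step-reserved (insRet _)     j = inj₁ refl
    step-reserved (extEmpty _ _) j = inj₁ refl
    step-reserved (tasFail _ _)  j = inj₁ refl
    step-reserved (retKey _)     j = inj₁ refl
    step-reserved (retNil _)     j = inj₁ refl

    winningTas-reserves : ∀ {s o j s'} → Step _<ₖ_ s (o , tas j false) s' →
                          reserved s j ≡ false × reserved s' j ≡ true
    winningTas-reserves {s} (tasWin {i = i} _ unreserved) = unreserved , upd-same (reserved s) (proj₁ i) true

    failingTas-reserved : ∀ {s o j s'} → Step _<ₖ_ s (o , tas j true) s' → reserved s j ≡ true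
    failingTas-reserved (tasFail _ r) = r

    step-reserved-mono : ∀ {s o a s'} j → Step _<ₖ_ s (o , a) s' → reserved s j ≡ true → reserved s' j ≡ true
    step-reserved-mono j stp r with step-reserved stp j
    ... | inj₁ eq   = trans eq r
    ... | inj₂ refl = proj₂ (winningTas-reserves stp)

    extractStep-min : ∀ {s o d i s'} → Step _<ₖ_ s (o , pqExt d (just i)) s' → IsMinIn _<ₖ_ d i (Q d s)
    extractStep-min (extGot _ least) = least

    extractStep-empty : ∀ {s o d s'} → Step _<ₖ_ s (o , pqExt d nothing) s' → Q d s ≡ []
    extractStep-empty (extEmpty _ empty) = empty

    insertStep-pushes : ∀ {s o d s'} → Step _<ₖ_ s (o , pqIns d) s' →
                        Σ (Item {Key}) λ i → pc s o ≡ pushes d i × i ∈ Q d s'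
    insertStep-pushes (insMinQ e) = _ , e , here refl
    insertStep-pushes (insMaxQ e) = _ , e , here refl

    stateAt : ∀ {s es s''} → Run _<ₖ_ s es s'' → ℕ → State {Key}
    stateAt {s} _          zero    = s
    stateAt {s} done       (suc n) = s
    stateAt     (step _ r) (suc n) = stateAt r n

    stateAt-step : ∀ {s es s''} (r : Run _<ₖ_ s es s'') k {ev} → at es k ≡ just ev →
                   Step _<ₖ_ (stateAt r k) ev (stateAt r (suc k))
    stateAt-step (step stp r) zero    refl = stp
    stateAt-step (step stp r) (suc k) eq   = stateAt-step r k eq

    stateAt-end : ∀ {s es s''} (r : Run _<ₖ_ s es s'') k → at es k ≡ nothing → stateAt r (suc k) ≡ stateAt r k
    stateAt-end done       zero    _  = refl
    stateAt-end done       (suc k) _  = refl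
    stateAt-end (step _ r) (suc k) eq = stateAt-end r k eq

module Execution {Key : Set} (_<ₖ_ : Key → Key → Set) (α : List (Event {Key}))
                 {sF : State {Key}} (run : Run _<ₖ_ initState α sF) where

  S : ℕ → State {Key}
  S = stateAt _<ₖ_ run

  step-at : ∀ {k o a} → Ev α k o a → Step _<ₖ_ (S k) (o , a) (S (suc k))
  step-at {k} = stateAt-step _<ₖ_ run k

  opStep-at : ∀ {k o a} → Ev α k o a → OpStep o a (pc (S k) o) (pc (S (suc k)) o)
  opStep-at e = step-opStep _<ₖ_ (step-at e)

  event-unique : ∀ {k o a o' a'} → Ev α k o a → Ev α k o' a' → o ≡ o' × a ≡ a'
  event-unique e e' with trans (sym e) e'
  ... | refl = refl , refl

  event-or-end : ∀ t → (Σ ℕ λ o → Σ (Action {Key}) λ a → Ev α t o a) ⊎ S (suc t) ≡ S t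
  event-or-end t with at α t in eq
  ... | nothing       = inj₂ (stateAt-end _<ₖ_ run t eq)
  ... | just (o , a) = inj₁ (o , a , refl)

  pc-evolution : ∀ o t → (Σ (Action {Key}) λ a → Ev α t o a × OpStep o a (pc (S t) o) (pc (S (suc t)) o))
                       ⊎ (pc (S (suc t)) o ≡ pc (S t) o × ∀ a → ¬ Ev α t o a)
  pc-evolution o t with at α t in eq
  ... | nothing = inj₂ (cong (λ s → pc s o) (stateAt-end _<ₖ_ run t eq) , λ _ ())
  ... | just (o' , a) with o ≟ o'
  ...   | yes refl = inj₁ (a , refl , opStep-at eq)
  ...   | no o≢o'  = inj₂ (step-pc-other _<ₖ_ o (step-at eq) o≢o' , λ { _ refl → o≢o' refl })

  phase-mono : ∀ o {t t'} → t ≤ t' → phase (pc (S t) o) ≤ phase (pc (S t') o)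
  phase-mono o t≤t' = upward-closed (λ t → _ ≤ phase (pc (S t) o)) next t≤t' ≤-refl
    where
    next : ∀ {t n} → n ≤ phase (pc (S t) o) → n ≤ phase (pc (S (suc t)) o)
    next {t} n≤ with pc-evolution o t
    ... | inj₁ (_ , _ , s) = ≤-trans n≤ (opStep-phase-mono s)
    ... | inj₂ (same , _)  = subst (λ c → _ ≤ phase c) (sym same) n≤

  phaseAfter≤phase : ∀ {k o a t} → Ev α k o a → k < t → phaseAfter a ≤ phase (pc (S t) o)
  phaseAfter≤phase {o = o} e k<t = ≤-trans (opStep-phaseAfter (opStep-at e)) (phase-mono o k<t)

  events-ordered : ∀ {k k' o a a'} → Ev α k o a → Ev α k' o a' → k < k' → phaseAfter a ≤ phaseBefore a'
  events-ordered e e' k<k' = ≤-trans (phaseAfter≤phase e k<k') (opStep-phaseBefore (opStep-at e'))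

  reserved-mono : ∀ j {t t'} → t ≤ t' → reserved (S t) j ≡ true → reserved (S t') j ≡ true
  reserved-mono j = upward-closed (λ t → reserved (S t) j ≡ true) next
    where
    next : ∀ {t} → reserved (S t) j ≡ true → reserved (S (suc t)) j ≡ true
    next {t} r with event-or-end t
    ... | inj₁ (_ , _ , e) = step-reserved-mono _<ₖ_ j (step-at e) r
    ... | inj₂ same        = subst (λ s → reserved s j ≡ true) (sym same) r

  maxInsAt? : ∀ o t → Dec (MaxInsAt α o t)
  maxInsAt? o t with at α t
  ... | nothing              = no λ ()
  ... | just (_ , invoke _)  = no λ ()
  ... | just (_ , pqIns min) = no λ ()
  ... | just (_ , pqExt _ _) = no λ ()
  ... | just (_ , tas _ _)   = no λ ()
  ... | just (_ , pqDel _ _) = no λ ()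
  ... | just (_ , respond _) = no λ ()
  ... | just (o' , pqIns max) with o' ≟ o
  ...   | yes refl = yes refl
  ...   | no o'≢o  = no λ { refl → o'≢o refl }

  OccursBefore : ℕ → ℕ → Action {Key} → Set
  OccursBefore t o a = Σ ℕ λ k → k < t × Ev α k o a

  occursBefore-suc : ∀ {t o a} → OccursBefore t o a → OccursBefore (suc t) o a
  occursBefore-suc (k , k<t , e) = k , m<n⇒m<1+n k<t , e

  QuietBetween : ℕ → ℕ → ℕ → Set
  QuietBetween o k₀ t = ∀ k a → k₀ < k → k < t → ¬ Ev α k o a

  ItemOf : ℕ → Item {Key} → Set
  ItemOf o i = proj₁ i ≡ o × Invoked α o (ins (proj₂ i))

  PcInv : ℕ → ℕ → PC {Key} → Set
  PcInv t o (insMinPC i)   = ItemOf o i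
  PcInv t o (insMaxPC i)   = ItemOf o i × OccursBefore t o (pqIns min)
  PcInv t o (extTry d)     = OccursBefore t o (invoke (ext d))
  PcInv t o (extTas d i)   = OccursBefore t o (invoke (ext d)) ×
                             Σ ℕ λ k₀ → k₀ < t × Ev α k₀ o (pqExt d (just i)) × QuietBetween o k₀ t
  PcInv t o (extWon d i)   = OccursBefore t o (tas (proj₁ i) false)
  PcInv t o _              = ⊤

  pushes-itemOf : ∀ {t o} d {i} → PcInv t o (pushes d i) → ItemOf o i
  pushes-itemOf min inv = inv
  pushes-itemOf max inv = proj₁ inv

  pcInv-step : ∀ {t o a c c'} → OpStep o a c c' → Ev α t o a → PcInv t o c → PcInv (suc t) o c'
  pcInv-step {t} pInvIns e _    = refl , t , e
  pcInv-step {t} pInvExt e _    = t , n<1+n t , e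
  pcInv-step {t} pInsMin e item = item , t , n<1+n t , e
  pcInv-step {t} pGot    e inv  =
    occursBefore-suc inv , t , n<1+n t , e , λ _ _ t<k k<1+t _ → <-irrefl refl (<-≤-trans t<k (s≤s⁻¹ k<1+t))
  pcInv-step     pFail   _ inv  = occursBefore-suc (proj₁ inv)
  pcInv-step {t} pWin    e _    = t , n<1+n t , e
  pcInv-step pInsMax _ _ = tt
  pcInv-step pInsRet _ _ = tt
  pcInv-step pEmpty  _ _ = tt
  pcInv-step pDel    _ _ = tt
  pcInv-step pRetWon _ _ = tt
  pcInv-step pRetDel _ _ = tt
  pcInv-step pRetNil _ _ = tt

  pcInv-quiet : ∀ {t o} c → (∀ a → ¬ Ev α t o a) → PcInv t o c → PcInv (suc t) o c
  pcInv-quiet idle             _     _   = tt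
  pcInv-quiet (insMinPC _)     _     inv = inv
  pcInv-quiet (insMaxPC _)     _     inv = map₂ occursBefore-suc inv
  pcInv-quiet insDone          _     _   = tt
  pcInv-quiet (extTry _)       _     inv = occursBefore-suc inv
  pcInv-quiet {t} (extTas _ _) quiet (inv , k₀ , k₀<t , e , q) =
    occursBefore-suc inv , k₀ , m<n⇒m<1+n k₀<t , e ,
    λ k a k₀<k k<1+t → extend k a k₀<k (m<1+n⇒m<n∨m≡n k<1+t)
    where
    extend : ∀ k a → k₀ < k → k < t ⊎ k ≡ t → ¬ Ev α k _ a
    extend k a k₀<k (inj₁ k<t) = q k a k₀<k k<t
    extend k a _    (inj₂ refl) = quiet a
  pcInv-quiet (extWon _ _)     _     inv = occursBefore-suc inv
  pcInv-quiet (extDeleted _ _) _     _   = tt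
  pcInv-quiet (extNil _)       _     _   = tt
  pcInv-quiet finished         _     _   = tt

  record Invariant (t : ℕ) : Set where
    field
      queued-inserted : ∀ {d i} → i ∈ Q d (S t) → Invoked α (proj₁ i) (ins (proj₂ i))
      reserved-won    : ∀ {j} → reserved (S t) j ≡ true → Σ ℕ λ o → OccursBefore t o (tas j false)
      pc-inv          : ∀ o → PcInv t o (pc (S t) o)

  invariant : ∀ t → Invariant t
  invariant zero = record
    { queued-inserted = λ { {min} () ; {max} () }
    ; reserved-won    = λ ()
    ; pc-inv          = λ _ → tt
    }
  invariant (suc t) = record
    { queued-inserted = λ {d} → queued {d}
    ; reserved-won    = won
    ; pc-inv          = pcInv
    }
    where
    open Invariant (invariant t)
    queued : ∀ {d i} → i ∈ Q d (S (suc t)) → Invoked α (proj₁ i) (ins (proj₂ i))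
    queued {d} {i} m with event-or-end t
    ... | inj₂ same = queued-inserted {d} (subst (λ s → i ∈ Q d s) same m)
    ... | inj₁ (o , a , e) with queueEffect-∈⁻ (step-queue _<ₖ_ (step-at e) d) m
    ...   | inj₁ m'      = queued-inserted {d} m'
    ...   | inj₂ pushing with pushes-itemOf d (subst (PcInv t o) pushing (pc-inv o))
    ...     | refl , inv = inv
    won : ∀ {j} → reserved (S (suc t)) j ≡ true → Σ ℕ λ o → OccursBefore (suc t) o (tas j false)
    won {j} r with event-or-end t
    ... | inj₂ same = map₂ occursBefore-suc (reserved-won (subst (λ s → reserved s j ≡ true) same r))
    ... | inj₁ (o , a , e) with step-reserved _<ₖ_ (step-at e) j
    ...   | inj₂ refl = o , t , n<1+n t , e
    ...   | inj₁ same = map₂ occursBefore-suc (reserved-won (trans (sym same) r))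
    pcInv : ∀ o → PcInv (suc t) o (pc (S (suc t)) o)
    pcInv o with pc-evolution o t
    ... | inj₁ (a , e , s)     = pcInv-step s e (pc-inv o)
    ... | inj₂ (same , quiet) rewrite same = pcInv-quiet _ quiet (pc-inv o)

  pcInv-at : ∀ t o → PcInv t o (pc (S t) o)
  pcInv-at t = Invariant.pc-inv (invariant t)

  same-time : ∀ {k k' o a a'} → Ev α k o a → Ev α k' o a' →
              ¬ (phaseAfter a ≤ phaseBefore a') → ¬ (phaseAfter a' ≤ phaseBefore a) → k ≡ k'
  same-time {k} {k'} e e' ¬a<a' ¬a'<a with <-cmp k k'
  ... | tri< k<k' _ _ = ⊥-elim (¬a<a' (events-ordered e e' k<k'))
  ... | tri≈ _ k≡k' _ = k≡k'
  ... | tri> _ _ k'<k = ⊥-elim (¬a'<a (events-ordered e' e k'<k))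

  -- ≤⇒≤ᵇ refutes a false inequality between numerals: its codomain evaluates to ⊥.
  invoked-unique : ∀ {o κ κ'} → Invoked α o κ → Invoked α o κ' → κ ≡ κ'
  invoked-unique (k , e) (k' , e') with same-time e e' ≤⇒≤ᵇ ≤⇒≤ᵇ
  ... | refl with event-unique e e'
  ...   | _ , refl = refl

  maxInsertion-once : ∀ {k k' o} → MaxInsAt α o k → MaxInsAt α o k' → k ≡ k'
  maxInsertion-once e e' = same-time e e' ≤⇒≤ᵇ ≤⇒≤ᵇ

  private
    reserved-conflict : ∀ {t t' o o' j} → Ev α t o (tas j false) → Ev α t' o' (tas j false) → ¬ t < t'
    reserved-conflict {j = j} e e' t<t' with
      trans (sym (proj₁ (winningTas-reserves _<ₖ_ (step-at e'))))
            (reserved-mono j t<t' (proj₂ (winningTas-reserves _<ₖ_ (step-at e))))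
    ... | ()

  winningTas-once : ∀ {t t' o o' j} → Ev α t o (tas j false) → Ev α t' o' (tas j false) → t ≡ t'
  winningTas-once {t} {t'} e e' with <-cmp t t'
  ... | tri< t<t' _ _ = ⊥-elim (reserved-conflict e e' t<t')
  ... | tri≈ _ t≡t' _ = t≡t'
  ... | tri> _ _ t'<t = ⊥-elim (reserved-conflict e' e t'<t)

  extraction-pc : ∀ {k o d r} → Ev α k o (pqExt d r) → pc (S k) o ≡ extTry d
  extraction-pc e = opStep-pqExt (opStep-at e)

  winningTas⇒linearized : ∀ {k₃ o j} → Ev α k₃ o (tas j false) →
                          Σ ℕ λ k₂ → k₂ < k₃ × Σ (Item {Key}) λ i → proj₁ i ≡ j × LinExt α o k₂ (just i)
  winningTas⇒linearized {k₃} {o} {j} e with opStep-tas (opStep-at e)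
  ... | d , i , holding , i≡j with subst (PcInv k₃ o) holding (pcInv-at k₃ o)
  ...   | _ , k₀ , k₀<k₃ , got , quiet =
    k₀ , k₀<k₃ , i , i≡j , ((d , got) , noLaterExtraction) , inj₂ (k₃ , j , e)
    where
    noLaterExtraction : ∀ k r → ExtAt α o k r → k ≤ k₀
    noLaterExtraction k r (_ , e') with <-cmp k k₀ | <-cmp k k₃
    ... | tri< k<k₀ _ _ | _             = <⇒≤ k<k₀
    ... | tri≈ _ refl _ | _             = ≤-refl
    ... | tri> _ _ k₀<k | tri< k<k₃ _ _ = ⊥-elim (quiet k _ k₀<k k<k₃ e')
    ... | tri> _ _ _    | tri≈ _ refl _ with proj₂ (event-unique e e')
    ...   | ()
    noLaterExtraction k r (_ , e') | tri> _ _ _ | tri> _ _ k₃<k = ⊥-elim (≤⇒≤ᵇ (events-ordered e e' k₃<k))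

  lastExt-unique : ∀ {o k r k' r'} → LastExt α o k r → LastExt α o k' r' → k ≡ k' × r ≡ r'
  lastExt-unique {k = k} {k' = k'} (x , latest) (x' , latest') with ≤-antisym (latest' k _ x) (latest k' _ x')
  ... | refl with proj₂ (event-unique (proj₂ x) (proj₂ x'))
  ...   | refl = refl , refl

  linearized-wins : ∀ {o k i} → LinExt α o k (just i) → Σ ℕ λ t → Ev α t o (tas (proj₁ i) false)
  linearized-wins (_ , inj₁ ())
  linearized-wins (last , inj₂ (t , j , e)) with winningTas⇒linearized e
  ... | _ , _ , _ , refl , lin with lastExt-unique last (proj₁ lin)
  ...   | refl , refl = t , e

  returned-unique : ∀ {o k i o' k' i'} → LinExt α o k (just i) → LinExt α o' k' (just i') →
                    proj₁ i ≡ proj₁ i' → k ≡ k' × o ≡ o' × i ≡ i'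
  returned-unique lin lin' same-id with linearized-wins lin | linearized-wins lin'
  ... | t , e | t' , e' rewrite same-id with winningTas-once e e'
  ...   | refl with event-unique e e'
  ...     | refl , _ with lastExt-unique (proj₁ lin) (proj₁ lin')
  ...       | refl , refl = refl , refl , refl

  ReturnedBefore : ℕ → ℕ → Set
  ReturnedBefore k j =
    Σ ℕ λ o → Σ ℕ λ k' → Σ (Item {Key}) λ i → k' < k × LinExt α o k' (just i) × proj₁ i ≡ j

  winningTas⇒returned : ∀ {t o j k} → Ev α t o (tas j false) → t < k → ReturnedBefore k j
  winningTas⇒returned {o = o} e t<k with winningTas⇒linearized e
  ... | k₂ , k₂<t , i , i≡j , lin = o , k₂ , i , <-trans k₂<t t<k , lin , i≡j

  TriedBefore : ℕ → ℕ → Item {Key} → Set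
  TriedBefore t o i = Σ ℕ λ t₂ → t₂ < t × Σ Bool λ b → Ev α t₂ o (tas (proj₁ i) b)

  holding-until-tas : ∀ {t₀ o d i} → pc (S t₀) o ≡ extTas d i → ∀ {t} → t₀ ≤ t →
                      pc (S t) o ≡ extTas d i ⊎ TriedBefore t o i
  holding-until-tas {o = o} {d} {i} holding t₀≤t = upward-closed Holding next t₀≤t (inj₁ holding)
    where
    Holding : ℕ → Set
    Holding t = pc (S t) o ≡ extTas d i ⊎ TriedBefore t o i
    next : ∀ {t} → Holding t → Holding (suc t)
    next (inj₂ (t₂ , t₂<t , tried)) = inj₂ (t₂ , m<n⇒m<1+n t₂<t , tried)
    next {t} (inj₁ still) with pc-evolution o t
    ... | inj₂ (same , _) = inj₁ (trans same still)
    ... | inj₁ (a , e , s) with opStep-fromTas (subst (λ c → OpStep o a c (pc (S (suc t)) o)) still s)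
    ...   | b , refl = inj₂ (t , n<1+n t , b , e)

  RemovedBefore : ℕ → Side → ℕ → Set
  RemovedBefore t d j = Σ ℕ λ t' → t' < t × Σ ℕ λ o → Σ (Action {Key}) λ a → Ev α t' o a × Removes d j a

  queued-until-removed : ∀ {t₁ d i} → i ∈ Q d (S t₁) → ∀ {t} → t₁ ≤ t →
                         i ∈ Q d (S t) ⊎ RemovedBefore t d (proj₁ i)
  queued-until-removed {d = d} {i} m t₁≤t = upward-closed Queued next t₁≤t (inj₁ m)
    where
    Queued : ℕ → Set
    Queued t = i ∈ Q d (S t) ⊎ RemovedBefore t d (proj₁ i)
    next : ∀ {t} → Queued t → Queued (suc t)
    next (inj₂ (t' , t'<t , removal)) = inj₂ (t' , m<n⇒m<1+n t'<t , removal)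
    next {t} (inj₁ m) with event-or-end t
    ... | inj₂ same = inj₁ (subst (λ s → i ∈ Q d s) (sym same) m)
    ... | inj₁ (o , a , e) with queueEffect-∈⁺ (step-queue _<ₖ_ (step-at e) d) m
    ...   | inj₁ m'      = inj₁ m'
    ...   | inj₂ removes = inj₂ (t , n<1+n t , o , a , e , removes)

  insertion-into : ∀ {km o} → MaxInsAt α o km → ∀ d → Σ ℕ λ td → td ≤ km × Ev α td o (pqIns d)
  insertion-into {km} maxIns max = km , ≤-refl , maxIns
  insertion-into {km} {o} maxIns min with insertStep-pushes _<ₖ_ (step-at maxIns)
  ... | _ , pushing , _ with proj₂ (subst (PcInv km o) pushing (pcInv-at km o))
  ...   | t₀ , t₀<km , e = t₀ , <⇒≤ t₀<km , e

  insertion-pushes : ∀ {td o d y} → Ev α td o (pqIns d) → Invoked α o (ins y) → (o , y) ∈ Q d (S (suc td))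
  insertion-pushes {td} {o} {d} e inserting with insertStep-pushes _<ₖ_ (step-at e)
  ... | i , pushing , m with pushes-itemOf d (subst (PcInv td o) pushing (pcInv-at td o))
  ...   | refl , inserting' with invoked-unique inserting' inserting
  ...     | refl = m

  queued-key : ∀ {t d o x y} → (o , x) ∈ Q d (S t) → Invoked α o (ins y) → (o , y) ∈ Q d (S t)
  queued-key {t} {d} m inserting with invoked-unique (Invariant.queued-inserted (invariant t) {d} m) inserting
  ... | refl = m

  pendingExt-at : ∀ {t o d} → OccursBefore t o (invoke (ext d)) → phase (pc (S t) o) ≤ 1 →
                  (∀ v → ¬ Ev α t o (respond v)) → PendingExt α d (suc t) o
  pendingExt-at {t} (k , k<t , invoked) phase≤1 notNow =
    (k , m<n⇒m<1+n k<t , invoked) , λ { (kr , v , kr<1+t , resp) → responded kr v (m<1+n⇒m<n∨m≡n kr<1+t) resp }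
    where
    responded : ∀ kr v → kr < t ⊎ kr ≡ t → ¬ Ev α kr _ (respond v)
    responded kr v (inj₁ kr<t) resp = ≤⇒≤ᵇ (≤-trans (phaseAfter≤phase resp kr<t) phase≤1)
    responded kr v (inj₂ refl) resp = notNow v resp

  linExt-side : ∀ {o k r} → LinExt α o k r → Σ Side λ d → Invoked α o (ext d) × Ev α k o (pqExt d r)
  linExt-side {o} {k} (((d , extraction) , _) , _)
    with subst (PcInv k o) (extraction-pc extraction) (pcInv-at k o)
  ... | t , _ , invocation = d , (t , invocation) , extraction

  returned-inserted : ∀ {o k i} → LinExt α o k (just i) → Invoked α (proj₁ i) (ins (proj₂ i))
  returned-inserted {k = k} (((d , extraction) , _) , _) =
    Invariant.queued-inserted (invariant k) {d} (proj₁ (extractStep-min _<ₖ_ (step-at extraction)))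

  linIns-unique : ∀ {o p p'} → LinIns α o p → LinIns α o p' → p ≡ p'
  linIns-unique (inj₁ (_ , maxIns , refl , _)) (inj₁ (_ , maxIns' , refl , _))
    with maxInsertion-once maxIns maxIns'
  ... | refl = refl
  linIns-unique (inj₂ (_ , _ , (_ , lin) , refl , _)) (inj₂ (_ , _ , (_ , lin') , refl , _))
    with returned-unique lin lin' refl
  ... | refl , _ = refl
  linIns-unique (inj₁ (k , maxIns , _ , beforeReturn)) (inj₂ (e , k' , returned , _ , beforeMaxIns)) =
    ⊥-elim (<-asym (beforeReturn e k' returned) (beforeMaxIns k maxIns))
  linIns-unique (inj₂ (e , k' , returned , _ , beforeMaxIns)) (inj₁ (k , maxIns , _ , beforeReturn)) =
    ⊥-elim (<-asym (beforeReturn e k' returned) (beforeMaxIns k maxIns))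

  linIns-before-return : ∀ {o p e k} → LinIns α o p → ReturnedBy α o e k → p < suc (2 * k)
  linIns-before-return {e = e} {k} (inj₁ (_ , _ , refl , beforeReturn)) returned =
    s≤s (*-monoʳ-< 2 (beforeReturn e k returned))
  linIns-before-return (inj₂ (_ , _ , (_ , lin) , refl , _)) (_ , lin') with returned-unique lin lin' refl
  ... | refl , _ = n<1+n _

  module AtExtraction {k e d r} (extraction : Ev α k e (pqExt d r)) (oneAtATime : OneAtATime α d) where

    private
      e-pending : PendingExt α d (suc k) e
      e-pending = pendingExt-at (subst (PcInv k e) (extraction-pc extraction) (pcInv-at k e))
                                (≤-reflexive (cong phase (extraction-pc extraction)))
                                (λ v resp → case proj₂ (event-unique extraction resp) of λ ())

    -- An item leaves Q d only through a Delete by the winner of its TestAndSet, or through an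
    -- extraction whose TestAndSet on it is decided before k: otherwise that extractor would be a
    -- second ExtractMin/Max on side d pending at time k.
    removed⇒returned : ∀ {j} → RemovedBefore k d j → ReturnedBefore k j
    removed⇒returned (t' , t'<k , o' , _ , e' , byDelete) with opStep-pqDel (opStep-at e')
    ... | _ , _ , won , refl with subst (PcInv t' o') won (pcInv-at t' o')
    ...   | t , t<t' , tasE = winningTas⇒returned tasE (<-trans t<t' t'<k)
    removed⇒returned (t' , t'<k , o' , _ , e' , byExtract refl) with holding-until-tas (opStep-got (opStep-at e')) t'<k
    ... | inj₂ (t₂ , t₂<k , false , tasE) = winningTas⇒returned tasE t₂<k
    ... | inj₂ (t₂ , t₂<k , true , tasE)
      with Invariant.reserved-won (invariant t₂) (failingTas-reserved _<ₖ_ (step-at tasE))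
    ...   | _ , t₃ , t₃<t₂ , winE = winningTas⇒returned winE (<-trans t₃<t₂ t₂<k)
    removed⇒returned (t' , t'<k , o' , _ , e' , byExtract refl) | inj₁ still with o' ≟ e
    ... | yes refl = case trans (sym still) (extraction-pc extraction) of λ ()
    ... | no o'≢e  = ⊥-elim (o'≢e (oneAtATime (suc k) o' e o'-pending e-pending))
      where
      o'-pending : PendingExt α d (suc k) o'
      o'-pending = pendingExt-at (proj₁ (subst (PcInv k o') still (pcInv-at k o')))
                                 (≤-reflexive (cong phase still))
                                 (λ v resp → o'≢e (proj₁ (event-unique resp extraction)))

    queued-at-extraction : ∀ {o y p} → Invoked α o (ins y) → LinIns α o p → p ≤ 2 * k →
                           ¬ ReturnedBefore k o → (o , y) ∈ Q d (S k)
    queued-at-extraction inserting (inj₂ (e' , k' , (_ , lin@(((_ , got) , _) , _)) , refl , _)) 2k'≤2k notReturned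
      with <-cmp k' k
    ... | tri< k'<k _ _ = ⊥-elim (notReturned (e' , k' , _ , k'<k , lin , refl))
    ... | tri> _ _ k<k' = ⊥-elim (<-irrefl refl (<-≤-trans k<k' (*-cancelˡ-≤ 2 2k'≤2k)))
    ... | tri≈ _ refl _ with event-unique got extraction
    ...   | refl , refl = queued-key {k} {d} (proj₁ (extractStep-min _<ₖ_ (step-at got))) inserting
    queued-at-extraction inserting (inj₁ (km , maxIns , refl , _)) 2km<2k notReturned
      with insertion-into maxIns d
    ... | td , td≤km , pushE with queued-until-removed (insertion-pushes pushE inserting)
                                    (≤-<-trans td≤km (*-cancelˡ-< 2 km k 2km<2k))
    ...   | inj₁ queued  = queued
    ...   | inj₂ removal = ⊥-elim (notReturned (removed⇒returned removal))

module Linearizability {Key : Set} (_<ₖ_ : Key → Key → Set) (sto : IsStrictTotalOrder _≡_ _<ₖ_)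
                       (α : List (Event {Key})) {sF : State {Key}} (run : Run _<ₖ_ initState α sF)
                       (oneAtATime : ∀ d → OneAtATime α d) (distinct : DistinctKeys α) where

  open Execution _<ₖ_ α run
  open SequentialDEPQ _<ₖ_

  inserter-unique : ∀ {o o' x} → Invoked α o (ins x) → Invoked α o' (ins x) → o ≡ o'
  inserter-unique (k , e) (k' , e') = distinct k k' _ _ _ e e'

  ord-connex : ∀ d {x y} → ¬ ord _<ₖ_ d y x → y ≢ x → ord _<ₖ_ d x y
  ord-connex d {x} {y} y≮x y≢x with IsStrictTotalOrder.compare sto x y | d
  ... | tri< x<y _ _ | min = x<y
  ... | tri< x<y _ _ | max = ⊥-elim (y≮x x<y)
  ... | tri≈ _ x≡y _ | _   = ⊥-elim (y≢x (sym x≡y))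
  ... | tri> _ _ y<x | min = ⊥-elim (y≮x y<x)
  ... | tri> _ _ y<x | max = y<x

  lin-ins⁻ : ∀ {o p h x} → Lin α o p h → h ≡ hIns x → Invoked α o (ins x) × LinIns α o p
  lin-ins⁻ (linIns inserting lin) refl = inserting , lin
  lin-ins⁻ (linExt _ _)           ()

  lin-ext⁻ : ∀ {o p h d x} → Lin α o p h → h ≡ hExt d (just x) →
             Σ ℕ λ k → Σ (Item {Key}) λ i → p ≡ suc (2 * k) × proj₂ i ≡ x × LinExt α o k (just i)
  lin-ext⁻ (linIns _ _)                      ()
  lin-ext⁻ (linExt {r = nothing} _ _)        ()
  lin-ext⁻ (linExt {k = k} {r = just i} _ lin) refl = k , i , refl , refl , lin

  -- The Insert of a returned item is linearized by (L2a) if its MaxPQ insertion precedes the return, by (L2b) otherwise.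
  returned-insert-linearized : ∀ {e k i} → LinExt α e k (just i) →
                               Σ ℕ λ p → p < suc (2 * k) × LinIns α (proj₁ i) p
  returned-insert-linearized {e} {k} {i} lin with anyUpTo? (maxInsAt? (proj₁ i)) k
  ... | yes (km , km<k , maxIns) =
    suc (2 * km) , s≤s (*-monoʳ-< 2 km<k) ,
    inj₁ (km , maxIns , refl , λ { _ _ (_ , lin') → subst (km <_) (proj₁ (returned-unique lin lin' refl)) km<k })
  ... | no noMaxInsBefore =
    2 * k , n<1+n (2 * k) , inj₂ (e , k , (proj₂ i , lin) , refl , after)
    where
    after : ∀ km → MaxInsAt α (proj₁ i) km → k < km
    after km maxIns with <-cmp k km
    ... | tri< k<km _ _ = k<km
    ... | tri≈ _ refl _ = case proj₂ (event-unique (proj₂ (proj₂ (linExt-side lin))) maxIns) of λ ()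
    ... | tri> _ _ km<k = ⊥-elim (noMaxInsBefore (km , km<k , maxIns))

  module History (L : List (LinEntry α)) (enum : Enumerates α L)
                 (P : List (LinEntry α)) (oa pa : ℕ) (ha : HEntry) (R : List (LinEntry α))
                 (split : L ≡ P ++ (oa , pa , ha) ∷ R) where

    entry : LinEntry α → HEntry
    entry b = proj₂ (proj₂ b)

    position : LinEntry α → ℕ
    position b = proj₁ (proj₂ b)

    H : List HEntry
    H = map entry P

    private
      increasing : Increasing position (P ++ (oa , pa , ha) ∷ R)
      increasing = subst (Increasing position) split (Linked⇒AllPairs <-trans (proj₂ (proj₂ enum)))

      lin-∈L : ∀ {b} → b ∈ L → Lin α (proj₁ b) (position b) (entry b)
      lin-∈L = All.lookup (proj₁ enum)

      lin-∈P : ∀ {b} → b ∈ P → Lin α (proj₁ b) (position b) (entry b)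
      lin-∈P b∈P = lin-∈L (subst (_ ∈_) (sym split) (∈-++⁺ˡ b∈P))

    lin⇒∈H : ∀ {o p h} → Lin α o p h → p < pa → h ∈ H
    lin⇒∈H lin p<pa = ∈-map⁺ entry (increasing-smaller⇒prefix position P increasing
                                      (subst (_ ∈_) split (proj₁ (proj₂ enum) _ _ _ lin)) p<pa)

    inserted-in-H : ∀ {x} → hIns x ∈ H → Σ ℕ λ o → Σ ℕ λ p → p < pa × Invoked α o (ins x) × LinIns α o p
    inserted-in-H m with ∈-map⁻ entry m
    ... | b , b∈P , eq =
      proj₁ b , position b , increasing-prefix position P increasing b∈P , lin-ins⁻ (lin-∈P b∈P) (sym eq)

    extracted-in-H : ∀ {d x} → hExt d (just x) ∈ H →
                     Σ ℕ λ o → Σ ℕ λ k → Σ (Item {Key}) λ i →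
                       suc (2 * k) < pa × proj₂ i ≡ x × LinExt α o k (just i)
    extracted-in-H m with ∈-map⁻ entry m
    ... | b , b∈P , eq with lin-ext⁻ (lin-∈P b∈P) (sym eq)
    ...   | k , i , refl , key , lin = proj₁ b , k , i , increasing-prefix position P increasing b∈P , key , lin

    lin-current : Lin α oa pa ha
    lin-current = lin-∈L (subst (_ ∈_) (sym split) (∈-++⁺ʳ P (here refl)))

    notExtracted⇒notReturned : ∀ {k o y} → pa ≡ suc (2 * k) → Invoked α o (ins y) → NotExtracted H y →
                               ¬ ReturnedBefore k o
    notExtracted⇒notReturned refl inserting notExtracted (_ , k' , _ , k'<k , lin , refl) with linExt-side lin
    ... | d , invoked , _ with invoked-unique (returned-inserted lin) inserting
    ...   | refl = notExtracted d (lin⇒∈H (linExt invoked lin) (s≤s (*-monoʳ-< 2 k'<k)))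

    live-queued : ∀ {e k d r y} → pa ≡ suc (2 * k) → Ev α k e (pqExt d r) → Live H y →
                  Σ ℕ λ o → (o , y) ∈ Q d (S k)
    live-queued refl extraction (ins∈H , notExtracted) with inserted-in-H ins∈H
    ... | o , _ , p<pa , inserting , lin =
      o , AtExtraction.queued-at-extraction extraction (oneAtATime _) inserting lin (s≤s⁻¹ p<pa)
                                            (notExtracted⇒notReturned refl inserting notExtracted)

    admissible-ins : ∀ {o x} → Invoked α o (ins x) → LinIns α o pa → Admissible H (hIns x)
    admissible-ins {x = x} inserting lin = notInserted , notExtracted
      where
      notInserted : hIns x ∉ H
      notInserted m with inserted-in-H m
      ... | _ , _ , p<pa , inserting' , lin' with inserter-unique inserting' inserting
      ...   | refl = <-irrefl (linIns-unique lin' lin) p<pa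
      notExtracted : NotExtracted H x
      notExtracted _ m with extracted-in-H m
      ... | _ , _ , i , returned<pa , refl , lin' with inserter-unique (returned-inserted lin') inserting
      ...   | refl = <-asym returned<pa (linIns-before-return lin (proj₂ i , lin'))

    admissible-nil : ∀ {e k d} → LinExt α e k nothing → pa ≡ suc (2 * k) → Admissible H (hExt d nothing)
    admissible-nil lin pa≡ y live with linExt-side lin
    ... | _ , _ , extraction with live-queued pa≡ extraction live
    ...   | _ , m with subst (_ ∈_) (extractStep-empty _<ₖ_ (step-at extraction)) m
    ...     | ()

    admissible-key : ∀ {e k d i} → Invoked α e (ext d) → LinExt α e k (just i) → pa ≡ suc (2 * k) →
                     Admissible H (hExt d (just (proj₂ i)))
    admissible-key {d = d} {i} invoked lin pa≡ = (inserted , notExtracted) , least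
      where
      inserted : hIns (proj₂ i) ∈ H
      inserted with returned-insert-linearized lin
      ... | p , p<2k+1 , linIns' = lin⇒∈H (linIns (returned-inserted lin) linIns') (subst (p <_) (sym pa≡) p<2k+1)
      notExtracted : NotExtracted H (proj₂ i)
      notExtracted _ m with extracted-in-H m
      ... | _ , _ , i' , returned<pa , key , lin'
        with inserter-unique (subst (λ x → Invoked α (proj₁ i') (ins x)) key (returned-inserted lin'))
                             (returned-inserted lin)
      ...   | same-inserter with returned-unique lin' lin same-inserter
      ...     | refl , _ = <-irrefl (sym pa≡) returned<pa
      least : ∀ y → Live H y → y ≢ proj₂ i → ord _<ₖ_ d (proj₂ i) y
      least y live y≢x with linExt-side lin
      ... | _ , invoked' , extraction with invoked-unique invoked' invoked
      ...   | refl with live-queued pa≡ extraction live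
      ...     | _ , m = ord-connex d (All.lookup (proj₂ (extractStep-min _<ₖ_ (step-at extraction))) m) y≢x

    admissible : Admissible H ha
    admissible = admissible-of lin-current refl refl
      where
      admissible-of : ∀ {o p h} → Lin α o p h → p ≡ pa → h ≡ ha → Admissible H ha
      admissible-of (linIns inserting lin)               refl refl = admissible-ins inserting lin
      admissible-of (linExt {d = d} {r = nothing} _ lin) refl refl = admissible-nil {d = d} lin refl
      admissible-of (linExt {r = just _} invoked lin)    refl refl = admissible-key invoked lin refl

  linearization-legal : (L : List (LinEntry α)) → Enumerates α L →
                        Legal _<ₖ_ [] (map (λ e → proj₂ (proj₂ e)) L)
  linearization-legal L enum = legal-if-admissible (λ e → proj₂ (proj₂ e)) L
    λ { P (oa , pa , ha) R split → History.admissible L enum P oa pa ha R split }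

mainTheorem2 : (Key : Set) (_<ₖ_ : Key → Key → Set) → IsStrictTotalOrder _≡_ _<ₖ_ →
    (α : List (Event {Key})) → Execution _<ₖ_ α →
    OneAtATime α min → OneAtATime α max → DistinctKeys α →
    (L : List (LinEntry α)) → Enumerates α L →
    Legal _<ₖ_ [] (map (λ e → proj₂ (proj₂ e)) L)
mainTheorem2 Key _<ₖ_ sto α (_ , run) oneMin oneMax distinct =
  Linearizability.linearization-legal _<ₖ_ sto α run oneAtATime distinct
  where
  oneAtATime : ∀ d → OneAtATime α d
  oneAtATime min = oneMin
  oneAtATime max = oneMax
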